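{- Let $F$ be an unsatisfiable hitting clause-set. If $F$ contains no fs-pair, then $F$ has no nontrivial clause-factor $F'$ with $c(F')\le 4$. If $F$ has no full variable, then $F$ has no nontrivial clause-factor $F'$ with $c(F')\ge c(F)-3$.
   Context: Variables are positive integers, literals are nonzero integers, the complement of $x$ is $\overline{x}=-x$. A clause is a finite set of literals with no pair $x,\overline{x}$. A clause-set is a finite set of clauses; $\top$ is the empty clause-set; $c(F)=|F|$. $F$ is satisfiable if some clause meets every clause of $F$, otherwise unsatisfiable. $F$ is hitting if any two distinct clauses $C,D\in F$ have some $x\in C$ with $\overline{x}\in D$. An fs-pair is a pair of clauses $\{E\cup\{v\},E\cup\{\overline v\}\}$ with $v,\overline v\notin E$. A full variable of $F$ is a variable occurring (positively or negatively) in every clause of $F$. A clause-set $F'\ne\top$ is a clause-factor if $\{D\setminus\bigcap F':D\in F'\}$ is unsatisfiable; a clause-factor of $F$ is a subset $F'\subseteq F$ which is a clause-factor; it is trivial if $c(F')=1$ or ($F'$ unsatisfiable and $F'=F$), otherwise nontrivial. -}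

module Defs where

open import Data.Nat using (ℕ; _≤_; _+_)
open import Data.Integer using (ℤ; -_; +_)
open import Data.Fin using (Fin)
open import Data.Fin.Subset using (Subset; ⊤; Nonempty; ∣_∣) renaming (_∈_ to _∈ₛ_)
open import Data.List using (List; _∷_)
open import Data.List.Membership.Propositional using (_∈_; _∉_)
open import Data.Product using (Σ; ∃; _×_; _,_)
open import Data.Sum using (_⊎_)
open import Relation.Nullary using (¬_)
open import Relation.Binary.PropositionalEquality using (_≡_; _≢_)
open import Function.Bundles using (_⇔_)

-- Literals: nonzero integers; complement is negation.
Lit : Set
Lit = ℤ

-- A clause is a finite set of literals (represented by a list, read as the
-- set of its members) containing only nonzero integers and no complementary pair.
IsClause : List ℤ → Set
IsClause C = (∀ x → x ∈ C → x ≢ + 0) × (∀ x → x ∈ C → - x ∈ C → Data.Empty.⊥)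
  where import Data.Empty

_≈_ : List ℤ → List ℤ → Set
C ≈ D = ∀ x → (x ∈ C ⇔ x ∈ D)

-- A clause-set with n clauses, given as an indexed family F : Fin n → clauses,
-- where distinct indices carry distinct clauses (so c(F) = n).
IsClauseSet : {n : ℕ} → (Fin n → List ℤ) → Set
IsClauseSet {n} F = (∀ i → IsClause (F i)) × (∀ i j → i ≢ j → ¬ (F i ≈ F j))

-- Satisfiability of a family of literal-sets (given by membership predicates):
-- some clause meets every member of the family.
SatFam : {I : Set} → (I → ℤ → Set) → Set
SatFam {I} P = ∃ λ (C : List ℤ) → IsClause C × (∀ i → ∃ λ x → x ∈ C × P i x)

Satisfiable : {n : ℕ} → (Fin n → List ℤ) → Set
Satisfiable {n} F = SatFam {Fin n} (λ i x → x ∈ F i)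

Unsatisfiable : {n : ℕ} → (Fin n → List ℤ) → Set
Unsatisfiable F = ¬ Satisfiable F

Hitting : {n : ℕ} → (Fin n → List ℤ) → Set
Hitting {n} F = ∀ i j → i ≢ j → ∃ λ x → x ∈ F i × - x ∈ F j

HasFsPair : {n : ℕ} → (Fin n → List ℤ) → Set
HasFsPair {n} F = ∃ λ (i : Fin n) → ∃ λ (j : Fin n) → ∃ λ (E : List ℤ) → ∃ λ (v : ℤ) →
  v ∉ E × - v ∉ E × (F i ≈ (v ∷ E)) × (F j ≈ (- v ∷ E))

HasFullVar : {n : ℕ} → (Fin n → List ℤ) → Set
HasFullVar {n} F = ∃ λ (v : ℕ) → (v ≢ 0) × (∀ i → (+ v ∈ F i) ⊎ (- (+ v) ∈ F i))

Sub : {n : ℕ} → (Fin n → List ℤ) → (S : Subset n) → Σ (Fin n) (λ i → i ∈ₛ S) → List ℤ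
Sub F S (i , _) = F i

InCap : {n : ℕ} → (Fin n → List ℤ) → Subset n → ℤ → Set
InCap F S x = ∀ j → j ∈ₛ S → x ∈ F j

IsClauseFactorOf : {n : ℕ} → (Fin n → List ℤ) → Subset n → Set
IsClauseFactorOf {n} F S =
  Nonempty S × ¬ SatFam {Σ (Fin n) (λ i → i ∈ₛ S)} (λ { (i , _) x → x ∈ F i × ¬ InCap F S x })

Trivial : {n : ℕ} → (Fin n → List ℤ) → Subset n → Set
Trivial {n} F S = (∣ S ∣ ≡ 1) ⊎ (¬ SatFam {Σ (Fin n) (λ i → i ∈ₛ S)} (λ p x → x ∈ Sub F S p) × S ≡ ⊤)

-- An unsatisfiable hitting clause-set with at most four clauses has a full variable. Take a
-- clash literal for each pair of clauses. If its variable occurs in a third clause without being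
-- full, the one clause missing it is forced to be a unit clause, whose variable is full. If no
-- clash variable leaves its pair, the clash literals along a cycle through all clauses form a
-- choice without complementary pair, contradicting unsatisfiability. Splitting on a full variable
-- and recursing into a side with two or more clauses then yields an fs-pair.
--
-- For a nontrivial clause-factor F' with c(F') ≤ 4 the family {D ∖ ⋂F'} is unsatisfiable and
-- hitting, and its fs-pair becomes one of F when ⋂F' is added back. If c(F') ≥ c(F) - 3,
-- replacing F' by the single clause ⋂F' leaves an unsatisfiable hitting family of at most four
-- clauses (⋂F' clashes with every clause D outside F', since otherwise the complement of D would
-- satisfy the factor), and a full variable of it is full in F.

module Submission where

open import Defs
open import Data.Nat using (ℕ; zero; suc; _≤_; _<_; _+_; s≤s; z≤n)
open import Data.Nat.Properties using (≤-trans; <⇒≱; <⇒≤; <-≤-trans; _≤?_; m≤n+o⇒m∸n≤o)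
open import Data.Nat.Induction using (<-rec)
open import Data.Integer using (ℤ; -_; +_; -[1+_])
open import Data.Integer.Properties using (neg-involutive; neg-injective) renaming (_≟_ to _≟ℤ_)
open import Data.Fin using (Fin; zero; suc)
open import Data.Fin.Properties using (_≟_; suc-injective; toℕ<n; any?; all?; ¬∀⟶∃¬; injective⇒≤)
open import Data.Fin.Subset using (Subset; ∣_∣; inside; outside; ∁; ⊤) renaming (_∈_ to _∈ₛ_)
open import Data.Fin.Subset.Properties
  using (∣⊤∣≡n; ∣∁p∣≡n∸∣p∣; ⊆-antisym; x∉p⇒x∈∁p; x∈∁p⇒x∉p; p⊂q⇒∣p∣<∣q∣; ⊆⊤; ∈⊤)
  renaming (_∈?_ to _∈ₛ?_)
open import Data.List as List using (List; _∷_; filter)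
open import Data.List.Membership.Propositional using (_∈_; _∉_; find; lose)
open import Data.List.Membership.Propositional.Properties
  using (∈-tabulate⁺; ∈-tabulate⁻; ∈-filter⁺; ∈-filter⁻; ∈-map⁺; ∈-map⁻)
open import Data.List.Relation.Unary.Any as Any using (here; there)
open import Data.List.Membership.DecPropositional _≟ℤ_ using () renaming (_∈?_ to _∈ℤ?_)
open import Data.Vec using (_∷_; []; tabulate) renaming (here to hereᵥ; there to thereᵥ)
open import Data.Vec.Properties using (lookup∘tabulate; lookup⇒[]=; []=⇒lookup)
open import Data.Vec.Relation.Unary.All using (_∷_; [])
open import Data.Vec.Relation.Unary.AllPairs using (_∷_; [])
open import Data.Vec.Relation.Unary.Unique.Propositional using (Unique)
open import Data.Vec.Relation.Unary.Unique.Propositional.Properties using (lookup-injective)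
open import Data.Product using (Σ; ∃; ∃₂; _×_; _,_; proj₁; proj₂)
open import Data.Sum using (_⊎_; inj₁; inj₂; swap)
open import Data.Empty using (⊥; ⊥-elim)
open import Function using (_∘_)
open import Function.Bundles using (_⇔_; mk⇔; Equivalence)
open import Relation.Nullary using (¬_; Dec; yes; no)
open import Relation.Nullary.Decidable using (does; dec-true; _⊎-dec_; _×-dec_; _→-dec_; ¬?)
open import Relation.Binary.PropositionalEquality using (_≡_; _≢_; refl; sym; trans; cong; subst; ≢-sym)

first-or-all : ∀ {k} {A : Set} {B : Fin k → Set} → (∀ i → A ⊎ B i) → A ⊎ (∀ i → B i)
first-or-all {zero} f = inj₂ λ ()
first-or-all {suc k} f with f zero | first-or-all (λ i → f (suc i))
... | inj₁ a  | _       = inj₁ a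
... | inj₂ _  | inj₁ a  = inj₁ a
... | inj₂ b₀ | inj₂ bs = inj₂ λ { zero → b₀ ; (suc i) → bs i }

four-distinct-exhaust : ∀ {k} → k ≤ 4 → {i j t s : Fin k} →
  i ≢ j → i ≢ t → i ≢ s → j ≢ t → j ≢ s → t ≢ s →
  ∀ r → r ≡ i ⊎ r ≡ j ⊎ r ≡ t ⊎ r ≡ s
four-distinct-exhaust k≤4 {i} {j} {t} {s} i≢j i≢t i≢s j≢t j≢s t≢s r
  with r ≟ i | r ≟ j | r ≟ t | r ≟ s
... | yes r≡i | _ | _ | _ = inj₁ r≡i
... | no _ | yes r≡j | _ | _ = inj₂ (inj₁ r≡j)
... | no _ | no _ | yes r≡t | _ = inj₂ (inj₂ (inj₁ r≡t))
... | no _ | no _ | no _ | yes r≡s = inj₂ (inj₂ (inj₂ r≡s))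
... | no r≢i | no r≢j | no r≢t | no r≢s =
  ⊥-elim (<⇒≱ (s≤s k≤4) (injective⇒≤ (lookup-injective distinct _ _)))
  where
  distinct : Unique (i ∷ j ∷ t ∷ s ∷ r ∷ [])
  distinct = (i≢j ∷ i≢t ∷ i≢s ∷ ≢-sym r≢i ∷ [])
           ∷ (j≢t ∷ j≢s ∷ ≢-sym r≢j ∷ [])
           ∷ (t≢s ∷ ≢-sym r≢t ∷ [])
           ∷ (≢-sym r≢s ∷ [])
           ∷ []
           ∷ []

not-one⇒2≤ : ∀ {m} → Fin m → m ≢ 1 → 2 ≤ m
not-one⇒2≤ {suc zero} _ m≢1 = ⊥-elim (m≢1 refl)
not-one⇒2≤ {suc (suc m)} _ _ = s≤s (s≤s z≤n)

distinct⇒2≤ : ∀ {m} {a b : Fin m} → a ≢ b → 2 ≤ m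
distinct⇒2≤ {suc zero} {zero} {zero} a≢b = ⊥-elim (a≢b refl)
distinct⇒2≤ {suc (suc m)} _ = s≤s (s≤s z≤n)

record Enumeration {n : ℕ} (S : Subset n) : Set where
  field
    index     : Fin ∣ S ∣ → Fin n
    injective : ∀ {a b} → index a ≡ index b → a ≡ b
    index∈    : ∀ a → index a ∈ₛ S
    onto      : ∀ {i} → i ∈ₛ S → ∃ λ a → index a ≡ i

enumerate : ∀ {n} (S : Subset n) → Enumeration S
enumerate [] = record { index = λ () ; injective = λ { {()} } ; index∈ = λ () ; onto = λ () }
enumerate (inside ∷ S) = record
  { index = λ { zero → zero ; (suc a) → suc (index a) }
  ; injective = λ { {zero} {zero} _ → refl
                  ; {suc a} {suc b} eq → cong suc (injective (suc-injective eq)) }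
  ; index∈ = λ { zero → hereᵥ ; (suc a) → thereᵥ (index∈ a) }
  ; onto = λ { {zero} _ → zero , refl
             ; {suc i} (thereᵥ i∈S) → let a , eq = onto i∈S in suc a , cong suc eq }
  }
  where open Enumeration (enumerate S)
enumerate (outside ∷ S) = record
  { index = λ a → suc (index a)
  ; injective = λ eq → injective (suc-injective eq)
  ; index∈ = λ a → thereᵥ (index∈ a)
  ; onto = λ { {suc i} (thereᵥ i∈S) → let a , eq = onto i∈S in a , cong suc eq }
  }
  where open Enumeration (enumerate S)

select : ∀ {n} {Q : Fin n → Set} → (∀ i → Dec (Q i)) → Subset n
select Q? = tabulate (λ i → does (Q? i))

∈-select⁺ : ∀ {n} {Q : Fin n → Set} (Q? : ∀ i → Dec (Q i)) {i} → Q i → i ∈ₛ select Q?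
∈-select⁺ Q? {i} q = lookup⇒[]= i _ (trans (lookup∘tabulate _ i) (dec-true (Q? i) q))

∈-select⁻ : ∀ {n} {Q : Fin n → Set} (Q? : ∀ i → Dec (Q i)) {i} → i ∈ₛ select Q? → Q i
∈-select⁻ Q? {i} i∈ with Q? i | trans (sym (lookup∘tabulate _ i)) ([]=⇒lookup i∈)
... | yes q | _ = q
... | no _ | ()

missing⇒∣∣< : ∀ {n} {S : Subset n} {i} → ¬ i ∈ₛ S → ∣ S ∣ < n
missing⇒∣∣< {n} {S} {i} i∉S = subst (∣ S ∣ <_) (∣⊤∣≡n n) (p⊂q⇒∣p∣<∣q∣ (⊆⊤ , i , ∈⊤ , i∉S))

LitSet : Set₁
LitSet = ℤ → Set

Occurs : LitSet → ℤ → Set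
Occurs C y = C y ⊎ C (- y)

occurs-neg : ∀ {C y} → Occurs C (- y) → Occurs C y
occurs-neg (inj₁ -y∈) = inj₂ -y∈
occurs-neg {C} {y} (inj₂ y∈) = inj₁ (subst C (neg-involutive y) y∈)

neg-flip : ∀ {x y : ℤ} → x ≡ - y → y ≡ - x
neg-flip {x} {y} x≡-y = trans (sym (neg-involutive y)) (cong -_ (sym x≡-y))

_∖_ : LitSet → ℤ → LitSet
(C ∖ w) x = C x × x ≢ w

-- Clauses are decidable predicates on literals, and unsatisfiability is phrased as: every
-- choice of one literal from each clause contains a complementary pair.
record IsUnsatHitting {k : ℕ} (P : Fin k → LitSet) : Set where
  field
    nonzero    : ∀ i x → P i x → x ≢ + 0
    consistent : ∀ i x → P i x → ¬ P i (- x)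
    member?    : ∀ i x → Dec (P i x)
    hitting    : ∀ i j → i ≢ j → ∃ λ x → P i x × P j (- x)
    unsat      : (s : Fin k → ℤ) → (∀ i → P i (s i)) → ∃₂ λ i j → s i ≡ - s j

Full : ∀ {k} → (Fin k → LitSet) → ℤ → Set
Full P y = ∀ i → Occurs (P i) y

Confined : ∀ {k} → (Fin k → LitSet) → ℤ → Fin k → Fin k → Set
Confined P y i j = ∀ t → Occurs (P t) y → t ≡ i ⊎ t ≡ j

full-neg : ∀ {k} {P : Fin k → LitSet} {y} → Full P y → Full P (- y)
full-neg {P = P} {y} full i with full i
... | inj₁ y∈ = inj₂ (subst (P i) (sym (neg-involutive y)) y∈)
... | inj₂ -y∈ = inj₁ -y∈

module UnsatHitting {k : ℕ} {P : Fin k → LitSet} (h : IsUnsatHitting P) where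
  open IsUnsatHitting h

  not-self-complementary : ∀ {i x} → P i x → x ≢ - x
  not-self-complementary {i} {x} x∈ x≡-x = nonzero i x x∈ (x≡-x⇒x≡0 x x≡-x)
    where
    x≡-x⇒x≡0 : ∀ x → x ≡ - x → x ≡ + 0
    x≡-x⇒x≡0 (+ zero) _ = refl
    x≡-x⇒x≡0 (+ suc n) ()
    x≡-x⇒x≡0 -[1+ n ] ()

  occurs? : ∀ i y → Dec (Occurs (P i) y)
  occurs? i y = member? i y ⊎-dec member? i (- y)

  full? : ∀ y → Dec (Full P y)
  full? y = all? (λ i → occurs? i y)

  unit⇒full : ∀ {t z} → P t z → (∀ x → P t x → x ≡ z) → Full P z
  unit⇒full {t} {z} z∈ unit i with i ≟ t
  ... | yes refl = inj₁ z∈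
  ... | no i≢t with hitting t i (≢-sym i≢t)
  ...   | x , x∈ , -x∈ = inj₂ (subst (λ y → P i (- y)) (unit x x∈) -x∈)

  occurs⇒nonzero : ∀ {i y} → Occurs (P i) y → y ≢ + 0
  occurs⇒nonzero {i} (inj₁ y∈) = nonzero i _ y∈
  occurs⇒nonzero {i} (inj₂ -y∈) refl = nonzero i _ -y∈ refl

  not-all-contain : ∀ w → ¬ (∀ i → P i w)
  not-all-contain w all = let i , _ , eq = unsat (λ _ → w) all in not-self-complementary (all i) eq

  -- Choosing x in i and - y everywhere else, x and - y must be complementary.
  lone⇒unit : ∀ {i y} → (∀ j → j ≢ i → P j (- y)) → ∀ x → P i x → x ≡ y
  lone⇒unit {i} {y} others x x∈i =
    let p , q , eq = unsat (λ j → pick (role j)) (λ j → pick∈ (role j))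
    in only (role p) (role q) eq
    where
    Role : Fin k → Set
    Role j = j ≡ i ⊎ P j (- y)
    role : ∀ j → Role j
    role j with j ≟ i
    ... | yes j≡i = inj₁ j≡i
    ... | no j≢i = inj₂ (others j j≢i)
    pick : ∀ {j} → Role j → ℤ
    pick (inj₁ _) = x
    pick (inj₂ _) = - y
    pick∈ : ∀ {j} (c : Role j) → P j (pick c)
    pick∈ (inj₁ refl) = x∈i
    pick∈ (inj₂ -y∈) = -y∈
    only : ∀ {p q} (c : Role p) (d : Role q) → pick c ≡ - pick d → x ≡ y
    only (inj₁ _) (inj₁ _) eq = ⊥-elim (not-self-complementary x∈i eq)
    only (inj₁ _) (inj₂ _) eq = trans eq (neg-involutive y)
    only (inj₂ _) (inj₁ _) eq = sym (neg-injective eq)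
    only (inj₂ -y∈) (inj₂ _) eq = ⊥-elim (not-self-complementary -y∈ eq)

  clash : ∀ {i j} → i ≢ j → ℤ
  clash {i} {j} i≢j = proj₁ (hitting i j i≢j)

  clash∈ : ∀ {i j} (i≢j : i ≢ j) → P i (clash i≢j)
  clash∈ {i} {j} i≢j = proj₁ (proj₂ (hitting i j i≢j))

  -clash∈ : ∀ {i j} (i≢j : i ≢ j) → P j (- clash i≢j)
  -clash∈ {i} {j} i≢j = proj₂ (proj₂ (hitting i j i≢j))

  -- Choosing x in s, the clash literal e in u and ℓ everywhere else, the only possible
  -- complementary pair is x, e: so s is the unit clause -e.
  lacking⇒full : ∀ {s u ℓ} → u ≢ s → ¬ Occurs (P s) ℓ → (∀ r → r ≡ s ⊎ r ≡ u ⊎ P r ℓ) →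
    ∃ (Full P)
  lacking⇒full {s} {u} {ℓ} u≢s ℓ∉s cover = - e , unit⇒full (-clash∈ u≢s) unit
    where
    e : ℤ
    e = clash u≢s
    Role : Fin k → Set
    Role r = r ≡ s ⊎ r ≡ u ⊎ P r ℓ
    unit : ∀ x → P s x → x ≡ - e
    unit x x∈s =
      let p , q , eq = unsat (λ r → pick (cover r)) (λ r → pick∈ (cover r))
      in only (cover p) (cover q) eq
      where
      pick : ∀ {r} → Role r → ℤ
      pick (inj₁ _) = x
      pick (inj₂ (inj₁ _)) = e
      pick (inj₂ (inj₂ _)) = ℓ
      pick∈ : ∀ {r} (c : Role r) → P r (pick c)
      pick∈ (inj₁ refl) = x∈s
      pick∈ (inj₂ (inj₁ refl)) = clash∈ u≢s
      pick∈ (inj₂ (inj₂ ℓ∈)) = ℓ∈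
      only : ∀ {p q} (c : Role p) (d : Role q) → pick c ≡ - pick d → x ≡ - e
      only (inj₁ _) (inj₁ _) eq = ⊥-elim (not-self-complementary x∈s eq)
      only (inj₁ _) (inj₂ (inj₁ _)) eq = eq
      only (inj₁ _) (inj₂ (inj₂ _)) eq = ⊥-elim (ℓ∉s (inj₂ (subst (P s) eq x∈s)))
      only (inj₂ (inj₁ _)) (inj₁ _) eq = neg-flip eq
      only (inj₂ (inj₁ _)) (inj₂ (inj₁ _)) eq = ⊥-elim (not-self-complementary (clash∈ u≢s) eq)
      only (inj₂ (inj₁ _)) (inj₂ (inj₂ _)) eq =
        ⊥-elim (ℓ∉s (inj₁ (subst (P s) (sym (neg-flip eq)) (-clash∈ u≢s))))
      only (inj₂ (inj₂ _)) (inj₁ _) eq = ⊥-elim (ℓ∉s (inj₂ (subst (P s) (neg-flip eq) x∈s)))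
      only (inj₂ (inj₂ _)) (inj₂ (inj₁ _)) eq =
        ⊥-elim (ℓ∉s (inj₁ (subst (P s) (sym eq) (-clash∈ u≢s))))
      only (inj₂ (inj₂ ℓ∈)) (inj₂ (inj₂ _)) eq = ⊥-elim (not-self-complementary ℓ∈ eq)

  -- If the variable x of clash i j is not full, it misses some clause s; as k ≤ 4 the
  -- clauses are then exactly i, j, t, s and lacking⇒full applies.
  third-occurrence⇒full : k ≤ 4 → ∀ {i j t} (i≢j : i ≢ j) → t ≢ i → t ≢ j →
    Occurs (P t) (clash i≢j) → ∃ (Full P)
  third-occurrence⇒full k≤4 {i} {j} {t} i≢j t≢i t≢j occ with full? (clash i≢j)
  ... | yes full = clash i≢j , full
  ... | no ¬full with ¬∀⟶∃¬ k _ (λ r → occurs? r (clash i≢j)) ¬full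
  ...   | s , x∉s = by-sign occ
    where
    x : ℤ
    x = clash i≢j
    s≢i : s ≢ i
    s≢i refl = x∉s (inj₁ (clash∈ i≢j))
    s≢j : s ≢ j
    s≢j refl = x∉s (inj₂ (-clash∈ i≢j))
    t≢s : t ≢ s
    t≢s refl = x∉s occ
    exhaust : ∀ r → r ≡ i ⊎ r ≡ j ⊎ r ≡ t ⊎ r ≡ s
    exhaust = four-distinct-exhaust k≤4 i≢j (≢-sym t≢i) (≢-sym s≢i) (≢-sym t≢j) (≢-sym s≢j) t≢s
    by-sign : Occurs (P t) x → ∃ (Full P)
    by-sign (inj₁ x∈t) = lacking⇒full (≢-sym s≢j) x∉s cover
      where
      cover : ∀ r → r ≡ s ⊎ r ≡ j ⊎ P r x
      cover r with exhaust r
      ... | inj₁ refl = inj₂ (inj₂ (clash∈ i≢j))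
      ... | inj₂ (inj₁ r≡j) = inj₂ (inj₁ r≡j)
      ... | inj₂ (inj₂ (inj₁ refl)) = inj₂ (inj₂ x∈t)
      ... | inj₂ (inj₂ (inj₂ r≡s)) = inj₁ r≡s
    by-sign (inj₂ -x∈t) = lacking⇒full (≢-sym s≢i) (x∉s ∘ occurs-neg {P s}) cover
      where
      cover : ∀ r → r ≡ s ⊎ r ≡ i ⊎ P r (- x)
      cover r with exhaust r
      ... | inj₁ r≡i = inj₂ (inj₁ r≡i)
      ... | inj₂ (inj₁ refl) = inj₂ (inj₂ (-clash∈ i≢j))
      ... | inj₂ (inj₂ (inj₁ refl)) = inj₂ (inj₂ -x∈t)
      ... | inj₂ (inj₂ (inj₂ r≡s)) = inj₁ r≡s

  full-or-confined : k ≤ 4 → ∀ {i j} (i≢j : i ≢ j) → ∃ (Full P) ⊎ Confined P (clash i≢j) i j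
  full-or-confined k≤4 {i} {j} i≢j
    with any? (λ t → ¬? (t ≟ i) ×-dec ¬? (t ≟ j) ×-dec occurs? t (clash i≢j))
  ... | yes (t , t≢i , t≢j , occ) = inj₁ (third-occurrence⇒full k≤4 i≢j t≢i t≢j occ)
  ... | no none = inj₂ confined
    where
    confined : Confined P (clash i≢j) i j
    confined t occ with t ≟ i | t ≟ j
    ... | yes t≡i | _ = inj₁ t≡i
    ... | no _ | yes t≡j = inj₂ t≡j
    ... | no t≢i | no t≢j = ⊥-elim (none (t , t≢i , t≢j , occ))

  -- Two of the chosen clash literals could only be complementary if q ≡ rot p and p ≡ rot q.
  confined-cycle-absurd : (rot : Fin k → Fin k) (rot≢ : ∀ p → p ≢ rot p) → (∀ p → rot (rot p) ≢ p) →
    (∀ p → Confined P (clash (rot≢ p)) p (rot p)) → ⊥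
  confined-cycle-absurd rot rot≢ rot²≢ confined
    with unsat (λ p → clash (rot≢ p)) (λ p → clash∈ (rot≢ p))
  ... | p , q , eq with confined p q (inj₂ (subst (P q) (neg-flip eq) (clash∈ (rot≢ q))))
                      | confined q p (inj₂ (subst (P p) eq (clash∈ (rot≢ p))))
  ...   | inj₁ refl | _ = not-self-complementary (clash∈ (rot≢ p)) eq
  ...   | inj₂ _ | inj₁ refl = not-self-complementary (clash∈ (rot≢ p)) eq
  ...   | inj₂ refl | inj₂ p≡rot²p = rot²≢ p (sym p≡rot²p)

  full-variable-by-cycle : k ≤ 4 → (rot : Fin k → Fin k) (rot≢ : ∀ p → p ≢ rot p) →
    (∀ p → rot (rot p) ≢ p) → ∃ (Full P)
  full-variable-by-cycle k≤4 rot rot≢ rot²≢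
    with first-or-all (λ p → full-or-confined k≤4 (rot≢ p))
  ... | inj₁ full = full
  ... | inj₂ confined = ⊥-elim (confined-cycle-absurd rot rot≢ rot²≢ confined)

open UnsatHitting using (full-variable-by-cycle)

rot₃ : Fin 3 → Fin 3
rot₃ zero = suc zero
rot₃ (suc zero) = suc (suc zero)
rot₃ (suc (suc zero)) = zero

rot₄ : Fin 4 → Fin 4
rot₄ zero = suc zero
rot₄ (suc zero) = suc (suc zero)
rot₄ (suc (suc zero)) = suc (suc (suc zero))
rot₄ (suc (suc (suc zero))) = zero

full-variable : ∀ {k} {P : Fin k → LitSet} → IsUnsatHitting P → 2 ≤ k → k ≤ 4 → ∃ (Full P)
full-variable {0} _ () _
full-variable {1} _ (s≤s ()) _
full-variable {2} h _ _ = clash 0≢1 , λ { zero → inj₁ (clash∈ 0≢1) ; (suc zero) → inj₂ (-clash∈ 0≢1) }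
  where
  open UnsatHitting h
  0≢1 : zero ≢ suc zero
  0≢1 ()
full-variable {3} h _ k≤4 = full-variable-by-cycle h k≤4 rot₃
  (λ { zero () ; (suc zero) () ; (suc (suc zero)) () })
  (λ { zero () ; (suc zero) () ; (suc (suc zero)) () })
full-variable {4} h _ k≤4 = full-variable-by-cycle h k≤4 rot₄
  (λ { zero () ; (suc zero) () ; (suc (suc zero)) () ; (suc (suc (suc zero))) () })
  (λ { zero () ; (suc zero) () ; (suc (suc zero)) () ; (suc (suc (suc zero))) () })
full-variable {suc (suc (suc (suc (suc _))))} _ _ (s≤s (s≤s (s≤s (s≤s ()))))

FsPair : LitSet → LitSet → Set
FsPair C D = ∃ λ v → C v × D (- v) × (∀ x → x ≢ v → x ≢ - v → C x ⇔ D x)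

HasFsPairIn : ∀ {k} → (Fin k → LitSet) → Set
HasFsPairIn P = ∃₂ λ i j → FsPair (P i) (P j)

fs-pair-restore : ∀ {C D R : LitSet} → (∀ x → Dec (R x)) → (∀ x → R x → C x × D x) →
  FsPair (λ x → C x × ¬ R x) (λ x → D x × ¬ R x) → FsPair C D
fs-pair-restore {C} {D} {R} R? R⊆ (v , (v∈C , _) , (-v∈D , _) , same) =
  v , v∈C , -v∈D , λ x x≢v x≢-v → mk⇔ (to x x≢v x≢-v) (from x x≢v x≢-v)
  where
  to : ∀ x → x ≢ v → x ≢ - v → C x → D x
  to x x≢v x≢-v x∈C with R? x
  ... | yes r = proj₂ (R⊆ x r)
  ... | no ¬r = proj₁ (Equivalence.to (same x x≢v x≢-v) (x∈C , ¬r))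
  from : ∀ x → x ≢ v → x ≢ - v → D x → C x
  from x x≢v x≢-v x∈D with R? x
  ... | yes r = proj₁ (R⊆ x r)
  ... | no ¬r = proj₁ (Equivalence.from (same x x≢v x≢-v) (x∈D , ¬r))

units⇒fs-pair : ∀ {C D : LitSet} {v} → C v → D (- v) → (∀ x → C x → x ≡ v) → (∀ x → D x → x ≡ - v) →
  FsPair C D
units⇒fs-pair v∈C -v∈D C⊆v D⊆-v = _ , v∈C , -v∈D , λ x x≢v x≢-v →
  mk⇔ (λ x∈C → ⊥-elim (x≢v (C⊆v x x∈C))) (λ x∈D → ⊥-elim (x≢-v (D⊆-v x x∈D)))

-- Setting w to false: the clauses containing - w are satisfied and dropped, the others
-- (listed by σ) lose w.
restrict : ∀ {k m} {P : Fin k → LitSet} {w} → IsUnsatHitting P →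
  (σ : Fin m → Fin k) → (∀ {a b} → σ a ≡ σ b → a ≡ b) → (∀ a → P (σ a) w) →
  (∀ i → (∃ λ a → σ a ≡ i) ⊎ P i (- w)) → IsUnsatHitting (λ a → P (σ a) ∖ w)
restrict {k} {m} {P} {w} h σ injective w∈ cover = record
  { nonzero = λ a x x∈ → nonzero (σ a) x (proj₁ x∈)
  ; consistent = λ a x x∈ -x∈ → consistent (σ a) x (proj₁ x∈) (proj₁ -x∈)
  ; member? = λ a x → member? (σ a) x ×-dec ¬? (x ≟ℤ w)
  ; hitting = hitting′
  ; unsat = unsat′
  }
  where
  open IsUnsatHitting h
  open UnsatHitting h using (not-self-complementary)
  hitting′ : ∀ a b → a ≢ b → ∃ λ x → (P (σ a) ∖ w) x × (P (σ b) ∖ w) (- x)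
  hitting′ a b a≢b with hitting (σ a) (σ b) (a≢b ∘ injective)
  ... | x , x∈ , -x∈ = x , (x∈ , λ { refl → consistent (σ b) w (w∈ b) -x∈ })
                         , (-x∈ , λ -x≡w → consistent (σ a) x x∈ (subst (P (σ a)) (sym -x≡w) (w∈ a)))
  unsat′ : (s : Fin m → ℤ) → (∀ a → (P (σ a) ∖ w) (s a)) → ∃₂ λ a b → s a ≡ - s b
  unsat′ s s∈ =
    let i , j , eq = unsat (λ i → extend (cover i)) (λ i → extend∈ (cover i))
    in back (cover i) (cover j) eq
    where
    Cover : Fin k → Set
    Cover i = (∃ λ a → σ a ≡ i) ⊎ P i (- w)
    extend : ∀ {i} → Cover i → ℤ
    extend (inj₁ (a , _)) = s a
    extend (inj₂ _) = - w
    extend∈ : ∀ {i} (c : Cover i) → P i (extend c)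
    extend∈ (inj₁ (a , refl)) = proj₁ (s∈ a)
    extend∈ (inj₂ -w∈) = -w∈
    back : ∀ {i j} (c : Cover i) (d : Cover j) → extend c ≡ - extend d → ∃₂ λ a b → s a ≡ - s b
    back (inj₁ (a , _)) (inj₁ (b , _)) eq = a , b , eq
    back (inj₁ (a , _)) (inj₂ _) eq = ⊥-elim (proj₂ (s∈ a) (trans eq (neg-involutive w)))
    back (inj₂ _) (inj₁ (b , _)) eq = ⊥-elim (proj₂ (s∈ b) (sym (neg-injective eq)))
    back (inj₂ -w∈) (inj₂ _) eq = ⊥-elim (not-self-complementary -w∈ eq)

module Side {k} {P : Fin k → LitSet} (h : IsUnsatHitting P) {w} (full : Full P w) where
  open IsUnsatHitting h
  open UnsatHitting h using (not-all-contain; lone⇒unit)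

  contains? : ∀ i → Dec (P i w)
  contains? i = member? i w

  Containing : Subset k
  Containing = select contains?

  open Enumeration (enumerate Containing) public

  family : Fin ∣ Containing ∣ → LitSet
  family a = P (index a) ∖ w

  restricted : IsUnsatHitting family
  restricted = restrict h index injective (λ a → ∈-select⁻ contains? (index∈ a)) cover
    where
    cover : ∀ i → (∃ λ a → index a ≡ i) ⊎ P i (- w)
    cover i with full i
    ... | inj₁ w∈ = inj₁ (onto (∈-select⁺ contains? w∈))
    ... | inj₂ -w∈ = inj₂ -w∈

  ∣Containing∣<k : ∣ Containing ∣ < k
  ∣Containing∣<k with ¬∀⟶∃¬ k _ (λ i → member? i w) (not-all-contain w)
  ... | i , w∉i = missing⇒∣∣< (w∉i ∘ ∈-select⁻ contains?)

  lift : HasFsPairIn family → HasFsPairIn P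
  lift (a , b , fs) =
    index a , index b , fs-pair-restore (_≟ℤ w) (λ { _ refl → contains a , contains b }) fs
    where
    contains : ∀ a → P (index a) w
    contains a = ∈-select⁻ contains? (index∈ a)

  unit : ¬ 2 ≤ ∣ Containing ∣ → ∃ λ i → P i w × (∀ x → P i x → x ≡ w)
  unit few with ¬∀⟶∃¬ k _ (λ i → member? i (- w)) (not-all-contain (- w))
  ... | i , -w∉i with full i
  ...   | inj₂ -w∈i = ⊥-elim (-w∉i -w∈i)
  ...   | inj₁ w∈i = i , w∈i , lone⇒unit others
    where
    sole : ∀ {j} → j ∈ₛ Containing → j ≡ i
    sole {j} j∈ with onto j∈ | onto (∈-select⁺ contains? w∈i)
    ... | a , ia≡j | b , ib≡i with a ≟ b
    ...   | yes a≡b = trans (sym ia≡j) (trans (cong index a≡b) ib≡i)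
    ...   | no a≢b = ⊥-elim (few (distinct⇒2≤ a≢b))
    others : ∀ j → j ≢ i → P j (- w)
    others j j≢i with full j
    ... | inj₁ w∈j = ⊥-elim (j≢i (sole (∈-select⁺ contains? w∈j)))
    ... | inj₂ -w∈j = -w∈j

fs-pair : ∀ {k} {P : Fin k → LitSet} → IsUnsatHitting P → 2 ≤ k → k ≤ 4 → HasFsPairIn P
fs-pair {k} = <-rec Motive step k
  where
  Motive : ℕ → Set₁
  Motive k = ∀ {P : Fin k → LitSet} → IsUnsatHitting P → 2 ≤ k → k ≤ 4 → HasFsPairIn P
  step : ∀ k → (∀ {m} → m < k → Motive m) → Motive k
  step k rec {P} h 2≤k k≤4 with full-variable h 2≤k k≤4
  ... | y , full = by-sides
    where
    module Pos = Side h full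
    module Neg = Side h { - y} (full-neg {P = P} full)
    recurse : ∀ {w} (full : Full P w) → 2 ≤ ∣ Side.Containing h full ∣ → HasFsPairIn P
    recurse full 2≤ = lift (rec ∣Containing∣<k restricted 2≤ (<⇒≤ (<-≤-trans ∣Containing∣<k k≤4)))
      where open Side h full
    by-sides : HasFsPairIn P
    by-sides with 2 ≤? ∣ Pos.Containing ∣ | 2 ≤? ∣ Neg.Containing ∣
    ... | yes 2≤ | _ = recurse full 2≤
    ... | no _ | yes 2≤ = recurse (full-neg {P = P} full) 2≤
    ... | no few | no few′ =
      let i , y∈i , i⊆y = Pos.unit few
          j , -y∈j , j⊆-y = Neg.unit few′
      in i , j , units⇒fs-pair y∈i -y∈j i⊆y j⊆-y

complementary-or-clause : ∀ {k} (s : Fin k → ℤ) → (∀ a → s a ≢ + 0) →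
  (∃₂ λ a b → s a ≡ - s b) ⊎ IsClause (List.tabulate s)
complementary-or-clause s nonzero
  with any? (λ a → any? (λ b → s a ≟ℤ - s b))
... | yes clash = inj₁ clash
... | no none = inj₂ (nonzero′ , consistent′)
  where
  nonzero′ : ∀ x → x ∈ List.tabulate s → x ≢ + 0
  nonzero′ x x∈ with ∈-tabulate⁻ x∈
  ... | a , refl = nonzero a
  consistent′ : ∀ x → x ∈ List.tabulate s → - x ∈ List.tabulate s → ⊥
  consistent′ x x∈ -x∈ with ∈-tabulate⁻ x∈ | ∈-tabulate⁻ -x∈
  ... | a , refl | b , -sa≡sb = none (b , a , sym -sa≡sb)

map-neg-isClause : ∀ {C} → IsClause C → IsClause (List.map -_ C)
map-neg-isClause {C} (nonzero , consistent) = nonzero′ , consistent′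
  where
  nonzero′ : ∀ x → x ∈ List.map -_ C → x ≢ + 0
  nonzero′ x x∈ with ∈-map⁻ -_ x∈
  ... | y , y∈ , refl = nonzero y y∈ ∘ neg-injective
  consistent′ : ∀ x → x ∈ List.map -_ C → - x ∈ List.map -_ C → ⊥
  consistent′ x x∈ -x∈ with ∈-map⁻ -_ x∈ | ∈-map⁻ -_ -x∈
  ... | y , y∈ , refl | z , z∈ , -x≡-z =
    consistent y y∈ (subst (_∈ C) (sym (neg-injective -x≡-z)) z∈)

fs-pair⇒lists : ∀ {C D} → IsClause C → IsClause D → FsPair (_∈ C) (_∈ D) →
  ∃₂ λ E v → v ∉ E × - v ∉ E × (C ≈ (v ∷ E)) × (D ≈ (- v ∷ E))
fs-pair⇒lists {C} {D} (_ , consistent-C) (_ , consistent-D) (v , v∈C , -v∈D , same) =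
  E , v , v∉E , -v∉E , (λ _ → mk⇔ to-C from-C) , (λ _ → mk⇔ to-D from-D)
  where
  E : List ℤ
  E = filter (λ z → ¬? (z ≟ℤ v)) C
  ∈E⁻ : ∀ {z} → z ∈ E → z ∈ C × z ≢ v
  ∈E⁻ = ∈-filter⁻ (λ z → ¬? (z ≟ℤ v))
  ∈E⁺ : ∀ {z} → z ∈ C → z ≢ v → z ∈ E
  ∈E⁺ = ∈-filter⁺ (λ z → ¬? (z ≟ℤ v))
  v∉E : v ∉ E
  v∉E v∈E = proj₂ (∈E⁻ v∈E) refl
  -v∉E : - v ∉ E
  -v∉E -v∈E = consistent-C v v∈C (proj₁ (∈E⁻ -v∈E))
  ≢-v : ∀ {z} → z ∈ C → z ≢ - v
  ≢-v z∈C refl = consistent-C v v∈C z∈C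
  ≢v : ∀ {z} → z ∈ D → z ≢ v
  ≢v z∈D refl = consistent-D v z∈D -v∈D
  to-C : ∀ {z} → z ∈ C → z ∈ v ∷ E
  to-C {z} z∈C with z ≟ℤ v
  ... | yes z≡v = here z≡v
  ... | no z≢v = there (∈E⁺ z∈C z≢v)
  from-C : ∀ {z} → z ∈ v ∷ E → z ∈ C
  from-C (here refl) = v∈C
  from-C (there z∈E) = proj₁ (∈E⁻ z∈E)
  to-D : ∀ {z} → z ∈ D → z ∈ - v ∷ E
  to-D {z} z∈D with z ≟ℤ - v
  ... | yes z≡-v = here z≡-v
  ... | no z≢-v = there (∈E⁺ (Equivalence.from (same z (≢v z∈D) z≢-v) z∈D) (≢v z∈D))
  from-D : ∀ {z} → z ∈ - v ∷ E → z ∈ D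
  from-D (here refl) = -v∈D
  from-D (there z∈E) =
    let z∈C , z≢v = ∈E⁻ z∈E in Equivalence.to (same _ z≢v (≢-v z∈C)) z∈C

occurs-everywhere⇒full-var : ∀ {n} {F : Fin n → List ℤ} y → y ≢ + 0 → (∀ i → Occurs (_∈ F i) y) →
  HasFullVar F
occurs-everywhere⇒full-var (+ zero) y≢0 _ = ⊥-elim (y≢0 refl)
occurs-everywhere⇒full-var (+ suc v) _ occurs = suc v , (λ ()) , occurs
occurs-everywhere⇒full-var -[1+ v ] _ occurs = suc v , (λ ()) , swap ∘ occurs

module ClauseSet {n} {F : Fin n → List ℤ} (cs : IsClauseSet F) (hit : Hitting F) where

  nonzero : ∀ i x → x ∈ F i → x ≢ + 0
  nonzero i = proj₁ (proj₁ cs i)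

  consistent : ∀ i x → x ∈ F i → ¬ - x ∈ F i
  consistent i = proj₂ (proj₁ cs i)

  inCap? : ∀ S x → Dec (InCap F S x)
  inCap? S x = all? (λ j → (j ∈ₛ? S) →-dec (x ∈ℤ? F j))

  module Factor {S : Subset n} (factor : IsClauseFactorOf F S) where

    core-clashes : ∀ {j} → ¬ j ∈ₛ S → ∃ λ x → InCap F S x × - x ∈ F j
    core-clashes {j} j∉S with Any.any? (λ z → inCap? S (- z)) (F j)
    ... | yes z∈ = let z , z∈j , -z∈core = find z∈ in
      - z , -z∈core , subst (_∈ F j) (sym (neg-involutive z)) z∈j
    ... | no none = ⊥-elim (proj₂ factor (List.map -_ (F j) , complement-clause , meets))
      where
      complement-clause : IsClause (List.map -_ (F j))
      complement-clause = map-neg-isClause (proj₁ cs j)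
      meets : ∀ (p : Σ (Fin n) (_∈ₛ S)) → ∃ λ x → x ∈ List.map -_ (F j) × x ∈ F (proj₁ p) × ¬ InCap F S x
      meets (i , i∈S) with hit j i (λ { refl → j∉S i∈S })
      ... | y , y∈j , -y∈i = - y , ∈-map⁺ -_ y∈j , -y∈i , λ -y∈core → none (lose y∈j -y∈core)

    module Members = Enumeration (enumerate S)

    reduced : Fin ∣ S ∣ → LitSet
    reduced a x = x ∈ F (Members.index a) × ¬ InCap F S x

    reduced-unsatHitting : IsUnsatHitting reduced
    reduced-unsatHitting = record
      { nonzero = λ a x x∈ → nonzero (index a) x (proj₁ x∈)
      ; consistent = λ a x x∈ -x∈ → consistent (index a) x (proj₁ x∈) (proj₁ -x∈)
      ; member? = λ a x → (x ∈ℤ? F (index a)) ×-dec ¬? (inCap? S x)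
      ; hitting = hitting′
      ; unsat = unsat′
      }
      where
      open Members
      hitting′ : ∀ a b → a ≢ b → ∃ λ x → reduced a x × reduced b (- x)
      hitting′ a b a≢b with hit (index a) (index b) (a≢b ∘ injective)
      ... | x , x∈ , -x∈ = x , (x∈ , λ x∈core → consistent (index b) x (x∈core _ (index∈ b)) -x∈)
                             , (-x∈ , λ -x∈core → consistent (index a) x x∈ (-x∈core _ (index∈ a)))
      unsat′ : (s : Fin ∣ S ∣ → ℤ) → (∀ a → reduced a (s a)) → ∃₂ λ a b → s a ≡ - s b
      unsat′ s s∈ with complementary-or-clause s (λ a → nonzero (index a) (s a) (proj₁ (s∈ a)))
      ... | inj₁ clash = clash
      ... | inj₂ clause = ⊥-elim (proj₂ factor (List.tabulate s , clause , meets))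
        where
        meets : ∀ (p : Σ (Fin n) (_∈ₛ S)) → ∃ λ x → x ∈ List.tabulate s × x ∈ F (proj₁ p) × ¬ InCap F S x
        meets (i , i∈S) with onto i∈S
        ... | a , refl = s a , ∈-tabulate⁺ a , s∈ a

    fs-pair-of-factor : ∣ S ∣ ≢ 1 → ∣ S ∣ ≤ 4 → HasFsPair F
    fs-pair-of-factor ∣S∣≢1 ∣S∣≤4 =
      let a , b , fs = fs-pair reduced-unsatHitting 2≤∣S∣ ∣S∣≤4
          fs′ = fs-pair-restore (inCap? S) (λ x x∈core → x∈core _ (index∈ a) , x∈core _ (index∈ b)) fs
      in index a , index b , fs-pair⇒lists (proj₁ cs (index a)) (proj₁ cs (index b)) fs′
      where
      open Members
      2≤∣S∣ : 2 ≤ ∣ S ∣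
      2≤∣S∣ = let i , i∈S = proj₁ factor in not-one⇒2≤ (proj₁ (onto i∈S)) ∣S∣≢1

    module Outside = Enumeration (enumerate (∁ S))

    contracted : Fin (suc ∣ ∁ S ∣) → LitSet
    contracted zero = InCap F S
    contracted (suc b) x = x ∈ F (Outside.index b)

    contracted-unsatHitting : Unsatisfiable F → IsUnsatHitting contracted
    contracted-unsatHitting unsatF = record
      { nonzero = nonzero′
      ; consistent = λ { zero x x∈core -x∈core → consistent i₀ x (x∈core i₀ i₀∈S) (-x∈core i₀ i₀∈S)
                       ; (suc b) → consistent (index b) }
      ; member? = λ { zero → inCap? S ; (suc b) x → x ∈ℤ? F (index b) }
      ; hitting = hitting′
      ; unsat = unsat′
      }
      where
      open Outside
      i₀ : Fin n
      i₀ = proj₁ (proj₁ factor)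
      i₀∈S : i₀ ∈ₛ S
      i₀∈S = proj₂ (proj₁ factor)
      nonzero′ : ∀ a x → contracted a x → x ≢ + 0
      nonzero′ zero x x∈core = nonzero i₀ x (x∈core i₀ i₀∈S)
      nonzero′ (suc b) = nonzero (index b)
      hitting′ : ∀ a b → a ≢ b → ∃ λ x → contracted a x × contracted b (- x)
      hitting′ zero zero 0≢0 = ⊥-elim (0≢0 refl)
      hitting′ zero (suc b) _ = core-clashes (x∈∁p⇒x∉p (index∈ b))
      hitting′ (suc b) zero _ =
        let x , x∈core , -x∈ = core-clashes (x∈∁p⇒x∉p (index∈ b))
        in - x , -x∈ , subst (InCap F S) (sym (neg-involutive x)) x∈core
      hitting′ (suc a) (suc b) sa≢sb = hit (index a) (index b) (λ eq → sa≢sb (cong suc (injective eq)))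
      unsat′ : (s : Fin (suc ∣ ∁ S ∣) → ℤ) → (∀ a → contracted a (s a)) → ∃₂ λ a b → s a ≡ - s b
      unsat′ s s∈ with complementary-or-clause s (λ a → nonzero′ a (s a) (s∈ a))
      ... | inj₁ clash = clash
      ... | inj₂ clause = ⊥-elim (unsatF (List.tabulate s , clause , meets))
        where
        meets : ∀ i → ∃ λ x → x ∈ List.tabulate s × x ∈ F i
        meets i with i ∈ₛ? S
        ... | yes i∈S = s zero , ∈-tabulate⁺ {f = s} zero , s∈ zero i i∈S
        ... | no i∉S with onto (x∉p⇒x∈∁p i∉S)
        ...   | b , refl = s (suc b) , ∈-tabulate⁺ {f = s} (suc b) , s∈ (suc b)

    full-var-of-factor : Unsatisfiable F → S ≢ ⊤ → n ≤ ∣ S ∣ + 3 → HasFullVar F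
    full-var-of-factor unsatF S≢⊤ n≤∣S∣+3 =
      let y , full = full-variable contracted-uh 2≤ ≤4
      in occurs-everywhere⇒full-var y (UnsatHitting.occurs⇒nonzero contracted-uh (full zero)) (everywhere full)
      where
      open Outside
      contracted-uh : IsUnsatHitting contracted
      contracted-uh = contracted-unsatHitting unsatF
      everywhere : ∀ {y} → Full contracted y → ∀ i → Occurs (_∈ F i) y
      everywhere full i with i ∈ₛ? S | full zero
      ... | yes i∈S | inj₁ y∈core = inj₁ (y∈core i i∈S)
      ... | yes i∈S | inj₂ -y∈core = inj₂ (-y∈core i i∈S)
      ... | no i∉S | _ with onto (x∉p⇒x∈∁p i∉S)
      ...   | b , refl = full (suc b)
      2≤ : 2 ≤ suc ∣ ∁ S ∣
      2≤ with ¬∀⟶∃¬ n _ (_∈ₛ? S) (λ all → S≢⊤ (⊆-antisym ⊆⊤ (λ {i} _ → all i)))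
      ... | i , i∉S = s≤s (≤-trans (s≤s z≤n) (toℕ<n (proj₁ (onto (x∉p⇒x∈∁p i∉S)))))
      ≤4 : suc ∣ ∁ S ∣ ≤ 4
      ≤4 = s≤s (subst (_≤ 3) (sym (∣∁p∣≡n∸∣p∣ S)) (m≤n+o⇒m∸n≤o n ∣ S ∣ n≤∣S∣+3))

lemma19 : (n : ℕ) (F : Fin n → List ℤ) → IsClauseSet F → Hitting F → Unsatisfiable F →
    (¬ HasFsPair F → ¬ (∃ λ (S : Subset n) → IsClauseFactorOf F S × ¬ Trivial F S × ∣ S ∣ ≤ 4))
    × (¬ HasFullVar F → ¬ (∃ λ (S : Subset n) → IsClauseFactorOf F S × ¬ Trivial F S × n ≤ ∣ S ∣ + 3))
lemma19 n F cs hit unsatF = no-small-factor , no-large-factor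
  where
  open ClauseSet cs hit
  no-small-factor : ¬ HasFsPair F →
    ¬ (∃ λ (S : Subset n) → IsClauseFactorOf F S × ¬ Trivial F S × ∣ S ∣ ≤ 4)
  no-small-factor no-fs (S , factor , nontrivial , ∣S∣≤4) =
    no-fs (Factor.fs-pair-of-factor factor (nontrivial ∘ inj₁) ∣S∣≤4)
  no-large-factor : ¬ HasFullVar F →
    ¬ (∃ λ (S : Subset n) → IsClauseFactorOf F S × ¬ Trivial F S × n ≤ ∣ S ∣ + 3)
  no-large-factor no-full (S , factor , nontrivial , n≤∣S∣+3) =
    no-full (Factor.full-var-of-factor factor unsatF S≢⊤ n≤∣S∣+3)
    where
    S≢⊤ : S ≢ ⊤
    S≢⊤ refl = nontrivial (inj₂ (unsat-⊤ , refl))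
      where
      unsat-⊤ : ¬ SatFam {Σ (Fin n) (_∈ₛ ⊤)} (λ p x → x ∈ Sub F ⊤ p)
      unsat-⊤ (C , clause , meets) = unsatF (C , clause , λ i → meets (i , ∈⊤))
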